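{- Let $G=(V,E)$ be a graph such that every pair of distinct vertices $u,v\in V$ has at least two non-adjacent common neighbors. Then $G$ does not belong to $\textsc{And}(1)$.
   Context: All graphs are finite, simple and connected. An $\textsc{And}(1)$-realization of a graph $G=(V,E)$ is a family $\{([L(v),R(v)],p_v):v\in V\}$ of closed real intervals and points $p_v\in[L(v),R(v)]$ such that for distinct $u,v$: $uv\in E$ iff $p_v\in[L(u),R(u)]$ and $p_u\in[L(v),R(v)]$. $\textsc{And}(1)$ is the class of graphs admitting an $\textsc{And}(1)$-realization. -}

module Defs where

open import Level using (Level; _⊔_; suc)
open import Data.Nat using (ℕ)
open import Data.Fin using (Fin)
open import Data.Product using (Σ; _×_; ∃-syntax)
open import Relation.Nullary using (¬_)
open import Relation.Binary.PropositionalEquality using (_≡_; _≢_)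
open import Relation.Binary.Bundles using (TotalOrder)
open import Relation.Binary.Construct.Closure.ReflexiveTransitive using (Star)
open import Function.Bundles using (_⇔_)

record Graph (n : ℕ) : Set₁ where
  field
    Adj       : Fin n → Fin n → Set
    sym       : ∀ {u v} → Adj u v → Adj v u
    irrefl    : ∀ {u} → ¬ Adj u u
    connected : ∀ u v → Star Adj u v

open Graph public

-- An And(1)-realization of G with endpoints/points taken in a totally
-- ordered set O (the paper uses the reals).
record And1Realization {c ℓ₁ ℓ₂ : Level} (O : TotalOrder c ℓ₁ ℓ₂) {n : ℕ} (G : Graph n)
       : Set (c ⊔ ℓ₂) where
  open TotalOrder O renaming (Carrier to A)
  field
    L R p   : Fin n → A
    L≤p     : ∀ v → L v ≤ p v
    p≤R     : ∀ v → p v ≤ R v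
    realizes : ∀ u v → u ≢ v →
      Adj G u v ⇔ ((L u ≤ p v × p v ≤ R u) × (L v ≤ p u × p u ≤ R v))

InAnd1 : {c ℓ₁ ℓ₂ : Level} (O : TotalOrder c ℓ₁ ℓ₂) {n : ℕ} (G : Graph n) → Set (c ⊔ ℓ₂)
InAnd1 O G = And1Realization O G

TwoNonAdjCommonNbrs : {n : ℕ} (G : Graph n) → Fin n → Fin n → Set
TwoNonAdjCommonNbrs G u v =
  ∃[ w₁ ] ∃[ w₂ ] (w₁ ≢ w₂ × ¬ Adj G w₁ w₂ ×
                   (Adj G u w₁ × Adj G v w₁) × (Adj G u w₂ × Adj G v w₂))

module Submission where

-- Suppose ρ is an And(1)-realization of G.  Among the (finitely
-- many) points p(x) choose a vertex u carrying the lowest point and a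
-- distinct vertex v carrying the highest one; two distinct such vertices exist
-- because G has at least two vertices.  If w is a common neighbour of u and v,
-- then adjacency forces p(u) and p(v) into the interval of w, so that interval
-- contains every point of the realization.  By hypothesis u and v have two
-- distinct common neighbours w₁, w₂; each interval then contains the other's
-- point, so the realization declares w₁ and w₂ adjacent — contradicting that
-- they are non-adjacent.

open import Defs
open import Level using (Level)
open import Data.Nat using (ℕ; _≥_; suc; s≤s; z≤n)
open import Data.Fin using (Fin; _≟_)
open import Data.Fin.Patterns using (0F; 1F)
open import Data.List using (allFin)
open import Data.List.Membership.Propositional.Properties using (∈-allFin)
import Data.List.Relation.Unary.All as All
import Data.List.Extrema as Extrema
open import Data.Product using (Σ-syntax; ∃-syntax; _×_; _,_; proj₂)
open import Function.Bundles using (Equivalence)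
open import Relation.Nullary using (¬_; yes; no)
open import Relation.Binary.PropositionalEquality using (_≢_; refl)
open import Relation.Binary.Bundles using (TotalOrder)

module FiniteExtrema {c ℓ₁ ℓ₂ : Level} (O : TotalOrder c ℓ₁ ℓ₂) {n : ℕ}
                     (f : Fin n → TotalOrder.Carrier O) where
  open TotalOrder O
  open Extrema O using (argmin; argmax; f[argmin]≤f[xs]; f[xs]≤f[argmax])

  -- Some index carries the least (resp. greatest) point of the family; the
  -- given index only witnesses that the index set is non-empty.
  minimiser : Fin n → ∃[ u ] (∀ w → f u ≤ f w)
  minimiser a = argmin f a (allFin n)
              , λ w → All.lookup (f[argmin]≤f[xs] a (allFin n)) (∈-allFin w)

  maximiser : Fin n → ∃[ v ] (∀ w → f w ≤ f v)
  maximiser a = argmax f a (allFin n)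
              , λ w → All.lookup (f[xs]≤f[argmax] a (allFin n)) (∈-allFin w)

  Spans : Fin n → Fin n → Set ℓ₂
  Spans u v = ∀ w → f u ≤ f w × f w ≤ f v

  -- If the chosen minimiser is also the chosen
  -- maximiser, all points coincide and any other index is a maximiser too.
  distinct-extremes : {a b : Fin n} → a ≢ b →
                      Σ[ u ∈ Fin n ] Σ[ v ∈ Fin n ] (u ≢ v × Spans u v)
  distinct-extremes {a} {b} a≢b with minimiser a | maximiser a
  ... | u , u-min | v , v-max with u ≟ v
  ...   | no u≢v   = u , v , u≢v , λ w → u-min w , v-max w
  ...   | yes refl = let y , u≢y = index-apart-from u in
                     u , y , u≢y , λ w → u-min w , trans (v-max w) (u-min y)
    where
    index-apart-from : (x : Fin n) → ∃[ y ] (x ≢ y)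
    index-apart-from x with x ≟ a
    ... | yes refl = b , a≢b
    ... | no x≢a   = a , x≢a

module Realization {c ℓ₁ ℓ₂ : Level} (O : TotalOrder c ℓ₁ ℓ₂) {n : ℕ} {G : Graph n}
                   (ρ : And1Realization O G) where
  open TotalOrder O
  open And1Realization ρ
  open FiniteExtrema O p using (Spans)

  Covers : Fin n → Set ℓ₂
  Covers w = ∀ x → L w ≤ p x × p x ≤ R w

  adjacent-distinct : {x y : Fin n} → Adj G x y → x ≢ y
  adjacent-distinct x~y refl = irrefl G x~y

  neighbour-point-inside : {x w : Fin n} → Adj G x w → L w ≤ p x × p x ≤ R w
  neighbour-point-inside {x} {w} x~w =
    proj₂ (Equivalence.to (realizes x w (adjacent-distinct x~w)) x~w)

  common-neighbour-covers : {u v w : Fin n} → Spans u v →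
                            Adj G u w → Adj G v w → Covers w
  common-neighbour-covers spans u~w v~w x =
    let Lw≤pu , _ = neighbour-point-inside u~w
        _ , pv≤Rw = neighbour-point-inside v~w
        pu≤px , px≤pv = spans x
    in trans Lw≤pu pu≤px , trans px≤pv pv≤Rw

  covering-vertices-adjacent : {w₁ w₂ : Fin n} → w₁ ≢ w₂ →
                               Covers w₁ → Covers w₂ → Adj G w₁ w₂
  covering-vertices-adjacent {w₁} {w₂} w₁≢w₂ cov₁ cov₂ =
    Equivalence.from (realizes w₁ w₂ w₁≢w₂) (cov₁ w₂ , cov₂ w₁)

corollary4 : {c ℓ₁ ℓ₂ : Level} (O : TotalOrder c ℓ₁ ℓ₂) (n : ℕ) → n ≥ 2 →
    (G : Graph n) →
    (∀ u v → u ≢ v → TwoNonAdjCommonNbrs G u v) →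
    ¬ InAnd1 O G
corollary4 O (suc (suc _)) (s≤s (s≤s z≤n)) G twoCommonNbrs ρ =
  let u , v , u≢v , spans = distinct-extremes {a = 0F} {b = 1F} (λ ())
      w₁ , w₂ , w₁≢w₂ , w₁≁w₂ , (u~w₁ , v~w₁) , (u~w₂ , v~w₂) = twoCommonNbrs u v u≢v
      covers₁ = common-neighbour-covers spans u~w₁ v~w₁
      covers₂ = common-neighbour-covers spans u~w₂ v~w₂
  in w₁≁w₂ (covering-vertices-adjacent w₁≢w₂ covers₁ covers₂)
  where
  open And1Realization ρ using (p)
  open FiniteExtrema O p using (distinct-extremes)
  open Realization O ρ using (common-neighbour-covers; covering-vertices-adjacent)
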